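{- Let $E$ be a uniform edifice and $\sigma$ a feedback function. Then $\mathrm{Tr}_\sigma(E)$ is uniform.
   Context: $W=\{\mathsf p,\mathsf q\}^*$ (finite words), $\mathcal C=\{\mathsf p,\mathsf q\}^{\mathbb N}$ (infinite words); for $s\in W\times W$ and $w\in\mathcal C\times\mathcal C$, $sw$ is componentwise concatenation. A pillar is $(u,i)$ with $u\in\mathcal C\times\mathcal C$, $i\in\mathbb N$. An arch is an unordered pair of pillars; an edifice is a set of arches. The vault generated by $\{(s,i),(t,j)\}$ with $s,t\in W\times W$, $i,j\in\mathbb N$ is $\{\{(sw,i),(tw,j)\}:w\in\mathcal C\times\mathcal C\}$. An edifice $E$ is uniform iff every arch of $E$ belongs to some vault contained in $E$. A feedback function is a fixpoint-free partial involution $\sigma$ on $\mathbb N$ with finite domain. A trace sequence of $E$ along $\sigma$ is a non-empty finite sequence of arches of $E$, each written with a chosen order of its pillars as $\{(u_k,i_k),(v_k,j_k)\}$, $1\le k\le n$, with $j_{k-1}\in\mathrm{dom}\,\sigma$, $i_k=\sigma(j_{k-1})$ and $u_k=v_{k-1}$ for $2\le k\le n$; it is visible if $i_1,j_n\notin\mathrm{dom}\,\sigma$. $\mathrm{Tr}_\sigma(E)$ is the set of arches $\{(u_1,i_1),(v_n,j_n)\}$ over visible trace sequences of $E$ along $\sigma$. -}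

module Defs where

open import Data.Nat using (ℕ; zero; suc; _≤_)
open import Data.List using (List; []; _∷_)
open import Data.Maybe using (Maybe; just; nothing)
open import Data.Product using (_×_; _,_; proj₁; proj₂; Σ; ∃; ∃-syntax)
open import Data.Sum using (_⊎_)
open import Relation.Binary.PropositionalEquality using (_≡_; _≢_)

data Letter : Set where
  p q : Letter

Word : Set
Word = List Letter

InfWord : Set
InfWord = ℕ → Letter

_·_ : Word → InfWord → InfWord
([] · w) n = w n
((x ∷ s) · w) zero = x
((x ∷ s) · w) (suc n) = (s · w) n

_··_ : Word × Word → InfWord × InfWord → InfWord × InfWord
(s₁ , s₂) ·· (w₁ , w₂) = (s₁ · w₁) , (s₂ · w₂)

Pillar : Set
Pillar = (InfWord × InfWord) × ℕ

_≈P_ : Pillar → Pillar → Set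
((u₁ , u₂) , i) ≈P ((v₁ , v₂) , j) =
  (∀ n → u₁ n ≡ v₁ n) × (∀ n → u₂ n ≡ v₂ n) × i ≡ j

-- equality of arches = unordered pairs {a,b}, {c,d}
ArchEq : Pillar → Pillar → Pillar → Pillar → Set
ArchEq a b c d = (a ≈P c × b ≈P d) ⊎ (a ≈P d × b ≈P c)

-- An edifice is presented by a relation E; the arch {a,b} belongs to the
-- edifice iff it equals (as unordered pair of pillars) some {c,d} with E c d.
Edifice : Set₁
Edifice = Pillar → Pillar → Set

_∋_⌢_ : Edifice → Pillar → Pillar → Set
E ∋ a ⌢ b = ∃[ c ] ∃[ d ] (E c d × ArchEq a b c d)

VaultIn : Edifice → Word × Word → ℕ → Word × Word → ℕ → Set
VaultIn E s i t j = ∀ (w : InfWord × InfWord) → E ∋ ((s ·· w) , i) ⌢ ((t ·· w) , j)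

InVault : Word × Word → ℕ → Word × Word → ℕ → Pillar → Pillar → Set
InVault s i t j a b = ∃[ w ] ArchEq a b ((s ·· w) , i) ((t ·· w) , j)

Uniform : Edifice → Set
Uniform E = ∀ a b → E ∋ a ⌢ b →
  ∃[ s ] ∃[ i ] ∃[ t ] ∃[ j ] (VaultIn E s i t j × InVault s i t j a b)

record Feedback : Set where
  field
    σ          : ℕ → Maybe ℕ
    involution : ∀ {i j} → σ i ≡ just j → σ j ≡ just i
    fixfree    : ∀ {i j} → σ i ≡ just j → i ≢ j
    finiteDom  : ∃[ N ] (∀ i → N ≤ i → σ i ≡ nothing)
open Feedback public

idx : Pillar → ℕ
idx = proj₂

word : Pillar → InfWord × InfWord
word = proj₁

-- Trace σ E a b : a trace sequence of E along σ whose first arch is written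
-- with first pillar a and whose last arch is written with second pillar b.
-- (Arches k and k+1 are {(u_k,i_k),(v_k,j_k)} and {(v_k, σ j_k), ...}.)
data Trace (σf : Feedback) (E : Edifice) : Pillar → Pillar → Set where
  single : ∀ {a b} → E ∋ a ⌢ b → Trace σf E a b
  step   : ∀ {a v j i′ b} → E ∋ a ⌢ (v , j) → σ σf j ≡ just i′ →
           Trace σf E (v , i′) b → Trace σf E a b

Tr : Feedback → Edifice → Edifice
Tr σf E a b = Trace σf E a b × σ σf (idx a) ≡ nothing × σ σf (idx b) ≡ nothing

-- By induction along a trace sequence, its end pillars lie in a vault all of
-- whose arches are traces. Two consecutive arches lie in vaults of E that
-- describe their shared pillar by two prefixes of the same infinite words;
-- such prefixes have a common extension, and extending the outer prefixes of
-- both vaults by it makes the shared pillars coincide for every continuation.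
module Submission where

open import Defs
open import Data.Nat using (zero; suc)
open import Data.List using ([]; _∷_; _++_)
open import Data.List.Properties using (++-identityʳ)
open import Data.Product using (_×_; _,_; ∃-syntax)
open import Data.Sum using (inj₁; inj₂)
open import Relation.Binary.PropositionalEquality
  using (_≡_; _≗_; refl; sym; trans; cong; cong₂)

infix 4 _≗₂_

_≗₂_ : InfWord × InfWord → InfWord × InfWord → Set
(u₁ , u₂) ≗₂ (v₁ , v₂) = u₁ ≗ v₁ × u₂ ≗ v₂

≗₂-sym : ∀ {u v} → u ≗₂ v → v ≗₂ u
≗₂-sym (f , g) = (λ n → sym (f n)) , (λ n → sym (g n))

≗₂-trans : ∀ {u v w} → u ≗₂ v → v ≗₂ w → u ≗₂ w
≗₂-trans (f , g) (f′ , g′) = (λ n → trans (f n) (f′ n)) , (λ n → trans (g n) (g′ n))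

≡⇒≗₂ : ∀ {u v} → u ≡ v → u ≗₂ v
≡⇒≗₂ refl = (λ _ → refl) , (λ _ → refl)

≈P-refl : ∀ {a} → a ≈P a
≈P-refl = (λ _ → refl) , (λ _ → refl) , refl

≈P-sym : ∀ {a b} → a ≈P b → b ≈P a
≈P-sym (f , g , e) = (λ n → sym (f n)) , (λ n → sym (g n)) , sym e

≈P-trans : ∀ {a b c} → a ≈P b → b ≈P c → a ≈P c
≈P-trans (f , g , e) (f′ , g′ , e′) =
  (λ n → trans (f n) (f′ n)) , (λ n → trans (g n) (g′ n)) , trans e e′

≗₂⇒≈P : ∀ {u v i} → u ≗₂ v → (u , i) ≈P (v , i)
≗₂⇒≈P (f , g) = f , g , refl

ArchEq-respˡ : ∀ {a b c d a′ b′} → a′ ≈P a → b′ ≈P b → ArchEq a b c d → ArchEq a′ b′ c d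
ArchEq-respˡ a′≈a b′≈b (inj₁ (a≈c , b≈d)) = inj₁ (≈P-trans a′≈a a≈c , ≈P-trans b′≈b b≈d)
ArchEq-respˡ a′≈a b′≈b (inj₂ (a≈d , b≈c)) = inj₂ (≈P-trans a′≈a a≈d , ≈P-trans b′≈b b≈c)

ArchEq-respʳ : ∀ {a b c d c′ d′} → c ≈P c′ → d ≈P d′ → ArchEq a b c d → ArchEq a b c′ d′
ArchEq-respʳ c≈c′ d≈d′ (inj₁ (a≈c , b≈d)) = inj₁ (≈P-trans a≈c c≈c′ , ≈P-trans b≈d d≈d′)
ArchEq-respʳ c≈c′ d≈d′ (inj₂ (a≈d , b≈c)) = inj₂ (≈P-trans a≈d d≈d′ , ≈P-trans b≈c c≈c′)

ArchEq-swap : ∀ {a b c d} → ArchEq a b c d → ArchEq b a c d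
ArchEq-swap (inj₁ (a≈c , b≈d)) = inj₂ (b≈d , a≈c)
ArchEq-swap (inj₂ (a≈d , b≈c)) = inj₁ (b≈c , a≈d)

∋-intro : ∀ {E a b} → E a b → E ∋ a ⌢ b
∋-intro {a = a} {b} e = a , b , e , inj₁ (≈P-refl , ≈P-refl)

∋-resp : ∀ {E a b a′ b′} → a ≈P a′ → b ≈P b′ → E ∋ a ⌢ b → E ∋ a′ ⌢ b′
∋-resp a≈a′ b≈b′ (c , d , e , ab≈cd) =
  c , d , e , ArchEq-respˡ (≈P-sym a≈a′) (≈P-sym b≈b′) ab≈cd

∋-sym : ∀ {E a b} → E ∋ a ⌢ b → E ∋ b ⌢ a
∋-sym (c , d , e , ab≈cd) = c , d , e , ArchEq-swap ab≈cd

Trace-resp : ∀ {σf E a b a′ b′} → a ≈P a′ → b ≈P b′ → Trace σf E a b → Trace σf E a′ b′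
Trace-resp a≈a′ b≈b′ (single a⌢b) = single (∋-resp a≈a′ b≈b′ a⌢b)
Trace-resp a≈a′ b≈b′ (step a⌢v σj v⇝b) =
  step (∋-resp a≈a′ ≈P-refl a⌢v) σj (Trace-resp ≈P-refl b≈b′ v⇝b)

·-cong : ∀ s {α β} → α ≗ β → s · α ≗ s · β
·-cong []      α≗β n       = α≗β n
·-cong (x ∷ s) α≗β zero    = refl
·-cong (x ∷ s) α≗β (suc n) = ·-cong s α≗β n

·-++ : ∀ s r α → (s ++ r) · α ≗ s · (r · α)
·-++ []      r α n       = refl
·-++ (x ∷ s) r α zero    = refl
·-++ (x ∷ s) r α (suc n) = ·-++ s r α n

·-commonExtension : ∀ s t α β → s · α ≗ t · β →
  ∃[ r ] ∃[ r′ ] ∃[ γ ] (s ++ r ≡ t ++ r′ × α ≗ r · γ × β ≗ r′ · γ)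
·-commonExtension [] t α β sα≗tβ =
  t , [] , β , sym (++-identityʳ t) , sα≗tβ , (λ _ → refl)
·-commonExtension (x ∷ s) [] α β sα≗tβ =
  [] , x ∷ s , α , ++-identityʳ (x ∷ s) , (λ _ → refl) , (λ n → sym (sα≗tβ n))
·-commonExtension (x ∷ s) (y ∷ t) α β sα≗tβ
  with sα≗tβ zero | ·-commonExtension s t α β (λ n → sα≗tβ (suc n))
... | refl | r , r′ , γ , s++r≡t++r′ , α≗ , β≗ =
  r , r′ , γ , cong (x ∷_) s++r≡t++r′ , α≗ , β≗

infixr 5 _++₂_

_++₂_ : Word × Word → Word × Word → Word × Word
(s₁ , s₂) ++₂ (r₁ , r₂) = (s₁ ++ r₁) , (s₂ ++ r₂)

··-cong : ∀ s {u v} → u ≗₂ v → s ·· u ≗₂ s ·· v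
··-cong (s₁ , s₂) (f , g) = ·-cong s₁ f , ·-cong s₂ g

··-++ : ∀ s r w → (s ++₂ r) ·· w ≗₂ s ·· (r ·· w)
··-++ (s₁ , s₂) (r₁ , r₂) (w₁ , w₂) = ·-++ s₁ r₁ w₁ , ·-++ s₂ r₂ w₂

··-commonExtension : ∀ s t u v → s ·· u ≗₂ t ·· v →
  ∃[ r ] ∃[ r′ ] ∃[ γ ] (s ++₂ r ≡ t ++₂ r′ × u ≗₂ r ·· γ × v ≗₂ r′ ·· γ)
··-commonExtension (s₁ , s₂) (t₁ , t₂) (u₁ , u₂) (v₁ , v₂) (f , g)
  with ·-commonExtension s₁ t₁ u₁ v₁ f | ·-commonExtension s₂ t₂ u₂ v₂ g
... | r₁ , r₁′ , γ₁ , e₁ , u₁≗ , v₁≗ | r₂ , r₂′ , γ₂ , e₂ , u₂≗ , v₂≗ =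
  (r₁ , r₂) , (r₁′ , r₂′) , (γ₁ , γ₂) , cong₂ _,_ e₁ e₂ , (u₁≗ , u₂≗) , (v₁≗ , v₂≗)

··-rebase : ∀ s r {u γ} → u ≗₂ r ·· γ → s ·· u ≗₂ (s ++₂ r) ·· γ
··-rebase s r u≗ = ≗₂-trans (··-cong s u≗) (≗₂-sym (··-++ s r _))

··-glue : ∀ s r t r′ w → s ++₂ r ≡ t ++₂ r′ → s ·· (r ·· w) ≗₂ t ·· (r′ ·· w)
··-glue s r t r′ w s++r≡t++r′ =
  ≗₂-trans (≗₂-sym (··-++ s r w))
    (≗₂-trans (≡⇒≗₂ (cong (_·· w) s++r≡t++r′)) (··-++ t r′ w))

-- Unlike InVault, this fixes the orientation of the vault and its indices.
InOrientedVault : Edifice → Pillar → Pillar → Set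
InOrientedVault R a b = ∃[ s ] ∃[ t ]
  ((∀ w → R ((s ·· w) , idx a) ((t ·· w) , idx b)) ×
   ∃[ w₀ ] (word a ≗₂ s ·· w₀ × word b ≗₂ t ·· w₀))

uniform⇒inOrientedVault : ∀ {E} → Uniform E → ∀ {a b} → E ∋ a ⌢ b →
  InOrientedVault (E ∋_⌢_) a b
uniform⇒inOrientedVault U {a} {b} a⌢b with U a b a⌢b
... | s , _ , t , _ , V , w₀ , inj₁ ((f , g , refl) , (f′ , g′ , refl)) =
  s , t , V , w₀ , (f , g) , (f′ , g′)
... | s , _ , t , _ , V , w₀ , inj₂ ((f , g , refl) , (f′ , g′ , refl)) =
  t , s , (λ w → ∋-sym (V w)) , w₀ , (f , g) , (f′ , g′)

trace⇒inOrientedVault : ∀ {E σf} → Uniform E → ∀ {a b} → Trace σf E a b →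
  InOrientedVault (Trace σf E) a b
trace⇒inOrientedVault U (single a⌢b) with uniform⇒inOrientedVault U a⌢b
... | s , t , V , w₀ , a≗ , b≗ = s , t , (λ w → single (V w)) , w₀ , a≗ , b≗
trace⇒inOrientedVault U (step a⌢v σj v⇝b)
  with uniform⇒inOrientedVault U a⌢v | trace⇒inOrientedVault U v⇝b
... | s , t , V , w₀ , a≗ , v≗ | s′ , t′ , T , w₀′ , v≗′ , b≗
  with ··-commonExtension t s′ w₀ w₀′ (≗₂-trans (≗₂-sym v≗) v≗′)
... | r , r′ , γ , t++r≡s′++r′ , w₀≗ , w₀′≗ =
  s ++₂ r , t′ ++₂ r′ ,
  (λ w → step (∋-resp (≗₂⇒≈P (≗₂-sym (··-++ s r w))) ≈P-refl (V (r ·· w))) σj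
              (Trace-resp (≗₂⇒≈P (≗₂-sym (··-glue t r s′ r′ w t++r≡s′++r′)))
                          (≗₂⇒≈P (≗₂-sym (··-++ t′ r′ w)))
                          (T (r′ ·· w)))) ,
  γ , ≗₂-trans a≗ (··-rebase s r w₀≗) , ≗₂-trans b≗ (··-rebase t′ r′ w₀′≗)

proposition3p10 : (E : Edifice) (σf : Feedback) → Uniform E → Uniform (Tr σf E)
proposition3p10 E σf U a b (c , d , (c⇝d , σc , σd) , ab≈cd)
  with trace⇒inOrientedVault U c⇝d
... | s , t , T , w₀ , c≗ , d≗ =
  s , idx c , t , idx d ,
  (λ w → ∋-intro (T w , σc , σd)) ,
  w₀ , ArchEq-respʳ (≗₂⇒≈P c≗) (≗₂⇒≈P d≗) ab≈cd
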